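{- A closed type $A$ of the guarded $\lambda$-calculus is total and inhabited if and only if the formula $\mathrm{TI}(A)\;:=\;\forall a':\blacktriangleright A,\ \exists a:A,\ a'=_{\blacktriangleright A}\mathsf{next}\,a$ is valid in the internal logic of the topos of trees.
   Context: Types of the guarded $\lambda$-calculus: $A ::= \alpha \mid \mathbf{N} \mid \mathbf{1} \mid A\times A \mid \mathbf{0} \mid A+A \mid A\to A \mid \mu\alpha.A \mid \blacktriangleright A \mid \blacksquare A$ ($\mu\alpha.A$ only for $\alpha$ guarded in $A$, $\blacksquare A$ only for closed $A$). The topos of trees $\mathcal S$: presheaves on the poset $1\le2\le\cdots$, i.e. families of sets $X_1,X_2,\dots$ with restriction maps $r^X_i:X_{i+1}\to X_i$, morphisms natural families of functions. $\blacktriangleright X$ has $(\blacktriangleright X)_1=\{*\}$, $(\blacktriangleright X)_{i+1}=X_i$; the natural transformation $\mathsf{next}:X\to\blacktriangleright X$ has $\mathsf{next}_1$ the unique map and $\mathsf{next}_{i+1}=r^X_i$. Types are interpreted as objects $[\![A]\!]$ in the standard way ($[\![\mathbf N]\!]=\Delta\mathbb N$ constant, $[\![\mathbf 0]\!]=\Delta\emptyset$, connectives by the categorical structure, $[\![\blacktriangleright A]\!]=\blacktriangleright[\![A]\!]$, $[\![\blacksquare A]\!]=\Delta\mathrm{Hom}(1,[\![A]\!])$, $[\![\mu\alpha.A]\!]$ the unique fixed point), and the term former $\mathsf{next}$ by the natural transformation $\mathsf{next}$. An $\mathcal S$-object is total and inhabited if all its restriction functions are surjective and all its sets are nonempty;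 a type is total and inhabited if its denotation is. -}

module Defs where

open import Level using (0ℓ)
open import Data.Nat using (ℕ; zero; suc; _≤_)
open import Data.Bool using (Bool; true; false)
open import Data.Vec using (Vec; []; _∷_)
open import Data.Unit using (⊤; tt)
open import Data.Empty using (⊥)
open import Data.Product using (Σ; _×_; _,_; proj₁; proj₂)
open import Data.Sum using (_⊎_; inj₁; inj₂)
open import Relation.Binary.Bundles using (Setoid)
open import Relation.Binary.Structures using (IsEquivalence)
open import Relation.Binary.PropositionalEquality as P using (_≡_; refl)
open import Function.Bundles using (Func; _⟨$⟩_)
import Data.Product.Relation.Binary.Pointwise.NonDependent as PW×
import Data.Sum.Relation.Binary.Pointwise as PW⊎

-- A context is a vector of flags: true = the type
-- variable may occur here ("now"), false = it may only occur beneath a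
-- ▸ ("later").  μ binds a "later" variable, so  μ A  is only formed when
-- the bound variable is guarded in A; ▸ makes all variables "now";
-- ■ only applies to closed types.

Ctx : ℕ → Set
Ctx = Vec Bool

nowAll : ∀ {k} → Ctx k → Ctx k
nowAll []      = []
nowAll (_ ∷ Γ) = true ∷ nowAll Γ

data Var : ∀ {k} → Ctx k → Set where
  here  : ∀ {k} {Γ : Ctx k} → Var (true ∷ Γ)
  there : ∀ {k} {b} {Γ : Ctx k} → Var Γ → Var (b ∷ Γ)

infixr 6 _⇒_
infixr 7 _⊕_
infixr 8 _⊗_

data Ty : ∀ {k} → Ctx k → Set where
  var  : ∀ {k} {Γ : Ctx k} → Var Γ → Ty Γ
  𝐍    : ∀ {k} {Γ : Ctx k} → Ty Γ
  𝟏    : ∀ {k} {Γ : Ctx k} → Ty Γ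
  _⊗_  : ∀ {k} {Γ : Ctx k} → Ty Γ → Ty Γ → Ty Γ
  𝟎    : ∀ {k} {Γ : Ctx k} → Ty Γ
  _⊕_  : ∀ {k} {Γ : Ctx k} → Ty Γ → Ty Γ → Ty Γ
  _⇒_  : ∀ {k} {Γ : Ctx k} → Ty Γ → Ty Γ → Ty Γ
  μ    : ∀ {k} {Γ : Ctx k} → Ty (false ∷ Γ) → Ty Γ
  ▸    : ∀ {k} {Γ : Ctx k} → Ty (nowAll Γ) → Ty Γ
  ■    : ∀ {k} {Γ : Ctx k} → Ty [] → Ty Γ

CTy : Set
CTy = Ty []

SET : Set₁
SET = Setoid 0ℓ 0ℓ

open Setoid using (Carrier)

⊤ₛ ⊥ₛ ℕₛ : SET
⊤ₛ = P.setoid ⊤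
⊥ₛ = P.setoid ⊥
ℕₛ = P.setoid ℕ

_×ₛ_ _⊎ₛ_ : SET → SET → SET
S ×ₛ T = PW×.×-setoid S T
S ⊎ₛ T = PW⊎.⊎-setoid S T

idF : (S : SET) → Func S S
idF S = record { to = λ x → x ; cong = λ e → e }

toTop : (S : SET) → Func S ⊤ₛ
toTop S = record { to = λ _ → tt ; cong = λ _ → refl }

_×F_ : ∀ {S S' T T'} → Func S S' → Func T T' → Func (S ×ₛ T) (S' ×ₛ T')
f ×F g = record { to = λ p → f ⟨$⟩ proj₁ p , g ⟨$⟩ proj₂ p
                ; cong = λ e → Func.cong f (proj₁ e) , Func.cong g (proj₂ e) }

_⊎F_ : ∀ {S S' T T'} → Func S S' → Func T T' → Func (S ⊎ₛ T) (S' ⊎ₛ T')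
_⊎F_ {S} {S'} {T} {T'} f g = record { to = h ; cong = c }
  where
  h : Carrier S ⊎ Carrier T → Carrier S' ⊎ Carrier T'
  h (inj₁ x) = inj₁ (f ⟨$⟩ x)
  h (inj₂ y) = inj₂ (g ⟨$⟩ y)
  c : ∀ {u v} → Setoid._≈_ (S ⊎ₛ T) u v → Setoid._≈_ (S' ⊎ₛ T') (h u) (h v)
  c (PW⊎.inj₁ e) = PW⊎.inj₁ (Func.cong f e)
  c (PW⊎.inj₂ e) = PW⊎.inj₂ (Func.cong g e)

record One : Set₁ where
  constructor ⋆

-- Truncated presheaves: TP n = stages 0 … n-1 with restriction maps.

mutual
  TP : ℕ → Set₁
  TP zero    = One
  TP (suc n) = Σ (TP n) λ Pr → Σ SET λ S → RestrTo Pr S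

  RestrTo : ∀ {n} → TP n → SET → Set
  RestrTo {zero}  _  S = ⊤
  RestrTo {suc n} Pr S = Func S (top Pr)

  top : ∀ {n} → TP (suc n) → SET
  top X = proj₁ (proj₂ X)

drop : ∀ {n} → TP (suc n) → TP n
drop = proj₁

restr : ∀ {n} (X : TP (suc (suc n))) → Func (top X) (top (drop X))
restr X = proj₂ (proj₂ X)

-- Exponential of presheaves, at stage n: natural families of maps over
-- all stages ≤ n.
mutual
  ExpC : ∀ {n} → TP (suc n) → TP (suc n) → Set
  ExpC {zero}  (_ , S , _) (_ , T , _) = Func S T
  ExpC {suc n} (Pr , S , r) (Q , T , q) =
    Σ (ExpC Pr Q) λ f → Σ (Func S T) λ g →
      ∀ x → Setoid._≈_ (top Q) (q ⟨$⟩ (g ⟨$⟩ x)) (topF Pr Q f ⟨$⟩ (r ⟨$⟩ x))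

  topF : ∀ {n} (X Y : TP (suc n)) → ExpC X Y → Func (top X) (top Y)
  topF {zero}  _ _ f           = f
  topF {suc n} _ _ (_ , g , _) = g

ExpEq : ∀ {n} (X Y : TP (suc n)) → ExpC X Y → ExpC X Y → Set
ExpEq {zero}  (_ , S , _) (_ , T , _) f g = ∀ x → Setoid._≈_ T (f ⟨$⟩ x) (g ⟨$⟩ x)
ExpEq {suc n} (Pr , S , _) (Q , T , _) (f , g , _) (f' , g' , _) =
  ExpEq Pr Q f f' × (∀ x → Setoid._≈_ T (g ⟨$⟩ x) (g' ⟨$⟩ x))

expRefl : ∀ {n} (X Y : TP (suc n)) (f : ExpC X Y) → ExpEq X Y f f
expRefl {zero}  (_ , S , _) (_ , T , _) f _ = Setoid.refl T
expRefl {suc n} (Pr , S , _) (Q , T , _) (f , g , _) = expRefl Pr Q f , λ _ → Setoid.refl T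

expSym : ∀ {n} (X Y : TP (suc n)) {f g : ExpC X Y} → ExpEq X Y f g → ExpEq X Y g f
expSym {zero}  (_ , S , _) (_ , T , _) e x = Setoid.sym T (e x)
expSym {suc n} (Pr , S , _) (Q , T , _) (e , e') = expSym Pr Q e , λ x → Setoid.sym T (e' x)

expTrans : ∀ {n} (X Y : TP (suc n)) {f g h : ExpC X Y} →
           ExpEq X Y f g → ExpEq X Y g h → ExpEq X Y f h
expTrans {zero}  (_ , S , _) (_ , T , _) e d x = Setoid.trans T (e x) (d x)
expTrans {suc n} (Pr , S , _) (Q , T , _) (e , e') (d , d') =
  expTrans Pr Q e d , λ x → Setoid.trans T (e' x) (d' x)

ExpS : ∀ {n} → TP (suc n) → TP (suc n) → SET
ExpS X Y = record
  { Carrier = ExpC X Y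
  ; _≈_ = ExpEq X Y
  ; isEquivalence = record
    { refl = λ {f} → expRefl X Y f
    ; sym = expSym X Y
    ; trans = expTrans X Y } }

expRes : ∀ {n} (X Y : TP (suc (suc n))) → Func (ExpS X Y) (ExpS (drop X) (drop Y))
expRes X Y = record { to = proj₁ ; cong = proj₁ }

-- Global sections  Hom(1, X)  of a presheaf given by stages and restrictions.
GS : (X : ℕ → SET) (r : ∀ k → Func (X (suc k)) (X k)) → SET
GS X r = record
  { Carrier = Σ (∀ k → Carrier (X k)) λ x → ∀ k → Setoid._≈_ (X k) (r k ⟨$⟩ x (suc k)) (x k)
  ; _≈_ = λ x y → ∀ k → Setoid._≈_ (X k) (proj₁ x k) (proj₁ y k)
  ; isEquivalence = record
    { refl = λ k → Setoid.refl (X k)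
    ; sym = λ e k → Setoid.sym (X k) (e k)
    ; trans = λ e d k → Setoid.trans (X k) (e k) (d k) } }

-- Environments: a "now" variable at stage n is given by its stages 0…n,
-- a "later" variable by its stages 0…n-1.

Entry : ℕ → Bool → Set₁
Entry n true  = TP (suc n)
Entry n false = TP n

Env : ∀ {k} → ℕ → Ctx k → Set₁
Env n []      = One
Env n (b ∷ Γ) = Env n Γ × Entry n b

dropE : ∀ {n} b → Entry (suc n) b → Entry n b
dropE true  = drop
dropE false = drop

trunc : ∀ {k n} {Γ : Ctx k} → Env (suc n) Γ → Env n Γ
trunc {Γ = []}    _       = ⋆
trunc {Γ = b ∷ Γ} (ρ , e) = trunc ρ , dropE b e

shiftE : ∀ {m} b → Entry (suc m) b → Entry m true
shiftE true  e = drop e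
shiftE false e = e

shift : ∀ {k m} {Γ : Ctx k} → Env (suc m) Γ → Env m (nowAll Γ)
shift {Γ = []}    _       = ⋆
shift {Γ = b ∷ Γ} (ρ , e) = shift ρ , shiftE b e

trunc-shift : ∀ {k m} {Γ : Ctx k} (ρ : Env (suc (suc m)) Γ) → trunc (shift ρ) ≡ shift (trunc ρ)
trunc-shift {Γ = []}        _       = refl
trunc-shift {Γ = true ∷ Γ}  (ρ , e) = P.cong (_, drop (drop e)) (trunc-shift ρ)
trunc-shift {Γ = false ∷ Γ} (ρ , e) = P.cong (_, drop e) (trunc-shift ρ)

lookup : ∀ {k n} {Γ : Ctx k} → Env n Γ → Var Γ → TP (suc n)
lookup (ρ , e) here      = e
lookup (ρ , _) (there x) = lookup ρ x

resVar : ∀ {k n} {Γ : Ctx k} (x : Var Γ) (ρ : Env (suc n) Γ) →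
         Func (top (lookup ρ x)) (top (lookup (trunc ρ) x))
resVar here      (ρ , e) = restr e
resVar (there x) (ρ , e) = resVar x ρ

-- Denotational semantics in the topos of trees (stage n here is stage
-- n+1 of the paper).  μ is interpreted as the fixed point built stage by
-- stage: the bound variable at stage n is given by the earlier stages
-- 0…n-1 of the μ-type itself.

mutual
  Stage : ∀ {k} {Γ : Ctx k} (n : ℕ) → Ty Γ → Env n Γ → SET
  Stage n (var x)   ρ = top (lookup ρ x)
  Stage n 𝐍         ρ = ℕₛ
  Stage n 𝟏         ρ = ⊤ₛ
  Stage n (A ⊗ B)   ρ = Stage n A ρ ×ₛ Stage n B ρ
  Stage n 𝟎         ρ = ⊥ₛ
  Stage n (A ⊕ B)   ρ = Stage n A ρ ⊎ₛ Stage n B ρ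
  Stage n (A ⇒ B)   ρ = ExpS (Trunc n A ρ) (Trunc n B ρ)
  Stage n B@(μ A)   ρ = Stage n A (ρ , Prev n B ρ)
  Stage zero (▸ A)  ρ = ⊤ₛ
  Stage (suc m) (▸ A) ρ = Stage m A (shift ρ)
  Stage n (■ A)     ρ = GS (λ j → Stage j A ⋆) (λ j → Restr j A ⋆)

  Prev : ∀ {k} {Γ : Ctx k} (n : ℕ) → Ty Γ → Env n Γ → TP n
  Prev zero    B ρ = ⋆
  Prev (suc m) B ρ = Trunc m B (trunc ρ)

  Trunc : ∀ {k} {Γ : Ctx k} (n : ℕ) → Ty Γ → Env n Γ → TP (suc n)
  Trunc n B ρ = Prev n B ρ , Stage n B ρ , RPrev n B ρ

  RPrev : ∀ {k} {Γ : Ctx k} (n : ℕ) (B : Ty Γ) (ρ : Env n Γ) → RestrTo (Prev n B ρ) (Stage n B ρ)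
  RPrev zero    B ρ = tt
  RPrev (suc m) B ρ = Restr m B ρ

  Restr : ∀ {k} {Γ : Ctx k} (n : ℕ) (A : Ty Γ) (ρ : Env (suc n) Γ) →
          Func (Stage (suc n) A ρ) (Stage n A (trunc ρ))
  Restr n (var x)   ρ = resVar x ρ
  Restr n 𝐍         ρ = idF ℕₛ
  Restr n 𝟏         ρ = idF ⊤ₛ
  Restr n (A ⊗ B)   ρ = Restr n A ρ ×F Restr n B ρ
  Restr n 𝟎         ρ = idF ⊥ₛ
  Restr n (A ⊕ B)   ρ = Restr n A ρ ⊎F Restr n B ρ
  Restr n (A ⇒ B)   ρ = expRes (Trunc (suc n) A ρ) (Trunc (suc n) B ρ)
  Restr n B@(μ A)   ρ = Restr n A (ρ , Trunc n B (trunc ρ))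
  Restr zero (▸ A)  ρ = toTop (Stage zero A (shift ρ))
  Restr (suc m) (▸ A) ρ =
    P.subst (λ σ → Func (Stage (suc m) A (shift ρ)) (Stage m A σ))
            (trunc-shift ρ) (Restr m A (shift ρ))
  Restr n (■ A)     ρ = idF (GS (λ j → Stage j A ⋆) (λ j → Restr j A ⋆))

record Psh : Set₁ where
  field
    Ob  : ℕ → SET
    res : ∀ n → Func (Ob (suc n)) (Ob n)

open Psh public

⟦_⟧ : CTy → Psh
⟦ A ⟧ = record { Ob = λ n → Stage n A ⋆ ; res = λ n → Restr n A ⋆ }

▶ : Psh → Psh
▶ X = record { Ob = ob ; res = rs }
  where
  ob : ℕ → SET
  ob zero    = ⊤ₛ
  ob (suc n) = Ob X n
  rs : ∀ n → Func (ob (suc n)) (ob n)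
  rs zero    = toTop (Ob X zero)
  rs (suc n) = res X n

next : (X : Psh) (n : ℕ) → Func (Ob X n) (Ob (▶ X) n)
next X zero    = toTop (Ob X zero)
next X (suc n) = res X n

Total : Psh → Set
Total X = ∀ n (y : Carrier (Ob X n)) →
          Σ (Carrier (Ob X (suc n))) λ x → Setoid._≈_ (Ob X n) (res X n ⟨$⟩ x) y

Inhabited : Psh → Set
Inhabited X = ∀ n → Carrier (Ob X n)

TotalInhabited : Psh → Set
TotalInhabited X = Total X × Inhabited X

Forall : (Y : Psh) → ((m : ℕ) → Carrier (Ob Y m) → Set) → ℕ → Set
Forall Y φ n = ∀ m → m ≤ n → (y : Carrier (Ob Y m)) → φ m y

Exists : (X : Psh) (m : ℕ) → (Carrier (Ob X m) → Set) → Set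
Exists X m ψ = Σ (Carrier (Ob X m)) ψ

Equal : (Y : Psh) (m : ℕ) → Carrier (Ob Y m) → Carrier (Ob Y m) → Set
Equal Y m a b = Setoid._≈_ (Ob Y m) a b

TI : Psh → ℕ → Set
TI X = Forall (▶ X) λ m a' → Exists X m λ a → Equal (▶ X) m a' (next X m ⟨$⟩ a)

Valid : (ℕ → Set) → Set
Valid φ = ∀ n → φ n

module Submission where

-- Nothing about the syntax of types is used: the equivalence holds for
-- every presheaf X on ω, and lemma3p6 is its instance at X = ⟦ A ⟧.
-- Both sides are compared with an intermediate notion: every component
-- next_m : X(m) → (▶X)(m) of the natural transformation next is surjective.
--
--  * By the Kripke–Joyal clause for ∀, stage n forces TI(X) iff next_m is
--    surjective for all m ≤ n; so TI(X) is valid iff every next_m is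
--    surjective (valid-TI⇔next-surjective).
--  * next_0 is the map X(0) → 1, surjective iff X(0) is nonempty, and
--    next_{m+1} is the restriction X(m+1) → X(m).  So next is surjective iff
--    X is total with X(0) nonempty; totality then propagates inhabitation
--    from stage 0 to all stages (total-inhabited⇔next-surjective).

open import Defs
open import Data.Nat using (zero; suc)
open import Data.Nat.Properties using (≤-refl)
open import Data.Product using (Σ; _,_; proj₁)
open import Relation.Binary.Bundles using (Setoid)
open import Relation.Binary.PropositionalEquality using (refl)
open import Function.Bundles using (_⇔_; mk⇔; _⟨$⟩_)
import Function.Properties.Equivalence as ⇔

open Setoid using (Carrier)

module _ (X : Psh) where

  NextSurjective : Set
  NextSurjective = ∀ m (a' : Carrier (Ob (▶ X) m)) →
                   Σ (Carrier (Ob X m)) λ a → Equal (▶ X) m a' (next X m ⟨$⟩ a)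

  -- TI only quantifies over earlier stages, so validity at all stages is
  -- the same as the existence claim at every single stage.
  valid-TI⇔next-surjective : Valid (TI X) ⇔ NextSurjective
  valid-TI⇔next-surjective =
    mk⇔ (λ valid m → valid m m ≤-refl) (λ surj _ m _ → surj m)

  inhabited-from-base : Total X → Carrier (Ob X zero) → Inhabited X
  inhabited-from-base total x₀ zero    = x₀
  inhabited-from-base total x₀ (suc n) =
    proj₁ (total n (inhabited-from-base total x₀ n))

  -- next_0 hits the point of 1 iff X(0) ≠ ∅; next_{m+1} is the restriction.
  total-inhabited⇔next-surjective : TotalInhabited X ⇔ NextSurjective
  total-inhabited⇔next-surjective = mk⇔ to from
    where
    to : TotalInhabited X → NextSurjective
    to (total , inhabited) zero    _ = inhabited zero , refl
    to (total , inhabited) (suc m) y =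
      let (x , rx≈y) = total m y in x , Setoid.sym (Ob X m) rx≈y

    total-from : NextSurjective → Total X
    total-from surj m y =
      let (x , y≈rx) = surj (suc m) y in x , Setoid.sym (Ob X m) y≈rx

    from : NextSurjective → TotalInhabited X
    from surj = total-from surj , inhabited-from-base (total-from surj) (proj₁ (surj zero _))

lemma3p6 : (A : CTy) → TotalInhabited ⟦ A ⟧ ⇔ Valid (TI ⟦ A ⟧)
lemma3p6 A = ⇔.trans (total-inhabited⇔next-surjective ⟦ A ⟧)
                     (⇔.sym (valid-TI⇔next-surjective ⟦ A ⟧))
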